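{- For every $v\geq 8$ there exists a connected symmetric configuration $v_3$ with strong chromatic number exactly $4$.
   Context: A symmetric configuration $v_3$ is a finite incidence structure consisting of a set $V$ of $v$ points and a collection of $v$ blocks, each block a $3$-element subset of $V$, such that each point lies in exactly $3$ blocks and any two distinct points lie together in at most one block. It is connected if it is not the union of two configurations on disjoint point sets. A strong colouring is an assignment of colours to points such that the three points of every block receive three distinct colours; the strong chromatic number is the minimum number of colours in a strong colouring (equivalently the chromatic number of the graph on $V$ joining two points iff they share a block). -}

module Defs where

open import Data.Nat using (ℕ)
open import Data.Fin using (Fin)
open import Data.Fin.Subset using (Subset; _∈_; _∉_; ⊥; ⊤)
open import Data.Product using (_×_; Σ; ∃; _,_)
open import Data.Sum using (_⊎_)
open import Data.List using (List; filter; length)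
open import Data.List using () renaming (allFin to allFinL)
open import Data.Fin using () renaming (_≟_ to _≟ᶠ_)
open import Relation.Nullary using (¬_; Dec; yes; no)
open import Relation.Binary.PropositionalEquality using (_≡_; _≢_)

-- A block: three (pairwise distinct, see IsConfig) points of Fin v.
record Block (v : ℕ) : Set where
  constructor ⟨_,_,_⟩
  field
    b₁ b₂ b₃ : Fin v
open Block public

_∈B_ : ∀ {v} → Fin v → Block v → Set
p ∈B b = (p ≡ b₁ b) ⊎ (p ≡ b₂ b) ⊎ (p ≡ b₃ b)

_∈B?_ : ∀ {v} (p : Fin v) (b : Block v) → Dec (p ∈B b)
p ∈B? b with p ≟ᶠ b₁ b | p ≟ᶠ b₂ b | p ≟ᶠ b₃ b
... | yes e | _ | _ = yes (Data.Sum.inj₁ e)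
... | no _ | yes e | _ = yes (Data.Sum.inj₂ (Data.Sum.inj₁ e))
... | no _ | no _ | yes e = yes (Data.Sum.inj₂ (Data.Sum.inj₂ e))
... | no a | no c | no d = no λ { (Data.Sum.inj₁ x) → a x
                                ; (Data.Sum.inj₂ (Data.Sum.inj₁ x)) → c x
                                ; (Data.Sum.inj₂ (Data.Sum.inj₂ x)) → d x }

Blocks : ℕ → Set
Blocks v = Fin v → Block v

degree : ∀ {v} → Blocks v → Fin v → ℕ
degree {v} B p = length (filter (λ j → p ∈B? B j) (allFinL v))

-- Symmetric configuration v_3:
--  * each block is a 3-element set (its three points are distinct),
--  * each point lies in exactly 3 blocks,
--  * two distinct points lie together in at most one block
--    (this also forces the v blocks to be pairwise distinct).
record IsConfig {v : ℕ} (B : Blocks v) : Set where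
  field
    distinct  : ∀ j → (b₁ (B j) ≢ b₂ (B j)) × (b₁ (B j) ≢ b₃ (B j)) × (b₂ (B j) ≢ b₃ (B j))
    regular   : ∀ p → degree B p ≡ 3
    linear    : ∀ p q i j → p ≢ q → p ∈B B i → q ∈B B i → p ∈B B j → q ∈B B j → i ≡ j

-- Connected: no splitting of the point set into two nonempty parts S, V∖S
-- such that every block lies entirely inside one part, i.e. every point set
-- S that is a union of blocks' point sets (a block meeting S lies in S) is
-- empty or everything.
Connected : ∀ {v} → Blocks v → Set
Connected {v} B =
  (S : Subset v) →
  (∀ j p q → p ∈B B j → q ∈B B j → p ∈ S → q ∈ S) →
  (∀ p → p ∉ S) ⊎ (∀ p → p ∈ S)

StrongColouring : ∀ {v} → Blocks v → (k : ℕ) → (Fin v → Fin k) → Set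
StrongColouring B k c =
  ∀ j → (c (b₁ (B j)) ≢ c (b₂ (B j))) × (c (b₁ (B j)) ≢ c (b₃ (B j))) × (c (b₂ (B j)) ≢ c (b₃ (B j)))

StronglyColourable : ∀ {v} → Blocks v → ℕ → Set
StronglyColourable {v} B k = Σ (Fin v → Fin k) (StrongColouring B k)

StrongChromaticNumber : ∀ {v} → Blocks v → ℕ → Set
StrongChromaticNumber B k = StronglyColourable B k × (∀ m → m Data.Nat.< k → ¬ StronglyColourable B m)

-- Configurations with 8 ≤ v ≤ 15 are given explicitly and certified by decision procedures.
-- Larger ones come from gluing an 8-point configuration onto a smaller one: a block {a, b, c}
-- of the first and a block {x, y, z} of the second are replaced by {a, b, z} and {x, y, c}.
-- Every point still lies on three blocks (c and z just change block) and two points still share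
-- at most one block, since only the two new blocks meet both halves and they share no point.
-- The new blocks link the halves, so the result is connected once each half stays connected
-- without its exchanged block; a strong 4-colouring survives after swapping two colours of the
-- second half so that c and z agree; and four pairwise collinear points force four colours.

module Submission where

open import Defs
open import Data.Nat using (ℕ; zero; suc; _+_; _<_; _≥_; _∸_) renaming (_≟_ to _≟ℕ_)
open import Data.Nat.Properties using (+-comm; m+[n∸m]≡n)
open import Data.Bool using (Bool; true; false)
open import Data.Bool.Properties using (⇔→≡)
open import Data.Empty using (⊥-elim)
open import Data.Fin using (Fin; zero; suc; inject₁; splitAt; join; _↑ˡ_; _↑ʳ_; #_)
open import Data.Fin.Properties
  using (_≟_; all?; any?; pigeonhole; <⇒≢; splitAt-↑ˡ; splitAt-↑ʳ; join-splitAt; ↑ˡ-injective; ↑ʳ-injective)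
open import Data.Fin.Permutation.Components using (transpose; transpose-inverse)
open import Data.Fin.Subset using () renaming (_∈_ to _∈ₛ_; _∉_ to _∉ₛ_)
open import Data.List using (List; filter; length; map; allFin)
open import Data.List.Properties using (length-map)
open import Data.List.Membership.Propositional using (_∈_)
open import Data.List.Membership.Propositional.Properties using (∈-filter⁺; ∈-filter⁻; ∈-allFin; ∈-map⁺; ∈-map⁻)
open import Data.List.Membership.Propositional.Properties.WithK using (unique∧set⇒bag)
open import Data.List.Relation.Unary.Unique.Propositional using (Unique)
open import Data.List.Relation.Unary.Unique.Propositional.Properties using (filter⁺; allFin⁺; map⁺)
open import Data.List.Relation.Binary.BagAndSetEquality using (∼bag⇒↭)
open import Data.List.Relation.Binary.Permutation.Propositional.Properties using (↭-length)
open import Data.Product using (Σ; ∃; _×_; _,_; proj₁; proj₂)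
open import Data.Sum using (_⊎_; inj₁; inj₂; [_,_]′)
open import Data.Vec using (lookup; _∷_; [])
open import Data.Vec.Properties using ([]=⇒lookup; lookup⇒[]=)
open import Function using (_∘_; _⇔_; mk⇔; Injective; Equivalence)
open import Function.Construct.Composition using (_⇔-∘_)
open import Function.Construct.Symmetry using (⇔-sym)
open import Relation.Binary.Definitions using (DecidableEquality; Symmetric)
open import Relation.Binary.PropositionalEquality
  using (_≡_; _≢_; refl; sym; trans; cong; subst; module ≡-Reasoning)
open import Relation.Nullary using (¬_; Dec; yes; no)
open import Relation.Nullary.Decidable using (True; toWitness; _×-dec_; _⊎-dec_; _→-dec_; ¬?; dec-true)
open import Relation.Unary using (Decidable)

AllDistinct : {A : Set} → A → A → A → Set
AllDistinct x y z = x ≢ y × x ≢ z × y ≢ z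

allDistinct? : {A : Set} → DecidableEquality A → (x y z : A) → Dec (AllDistinct x y z)
allDistinct? _≟_ x y z = ¬? (x ≟ y) ×-dec ¬? (x ≟ z) ×-dec ¬? (y ≟ z)

map-allDistinct : {A B : Set} {f : A → B} → Injective _≡_ _≡_ f →
  ∀ {x y z} → AllDistinct x y z → AllDistinct (f x) (f y) (f z)
map-allDistinct f-inj (x≢y , x≢z , y≢z) = x≢y ∘ f-inj , x≢z ∘ f-inj , y≢z ∘ f-inj

allDistinct-cong : {A : Set} {x y z x′ y′ z′ : A} → x ≡ x′ → y ≡ y′ → z ≡ z′ → AllDistinct x y z → AllDistinct x′ y′ z′
allDistinct-cong refl refl refl distinct = distinct

pairwise-on-block : ∀ {v} (R : Fin v → Fin v → Set) → Symmetric R → ∀ {bl p q} →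
  R (b₁ bl) (b₂ bl) → R (b₁ bl) (b₃ bl) → R (b₂ bl) (b₃ bl) →
  p ≢ q → p ∈B bl → q ∈B bl → R p q
pairwise-on-block R R-sym r₁₂ r₁₃ r₂₃ p≢q = λ where
  (inj₁ refl)        (inj₁ refl)        → ⊥-elim (p≢q refl)
  (inj₁ refl)        (inj₂ (inj₁ refl)) → r₁₂
  (inj₁ refl)        (inj₂ (inj₂ refl)) → r₁₃
  (inj₂ (inj₁ refl)) (inj₁ refl)        → R-sym r₁₂
  (inj₂ (inj₁ refl)) (inj₂ (inj₁ refl)) → ⊥-elim (p≢q refl)
  (inj₂ (inj₁ refl)) (inj₂ (inj₂ refl)) → r₂₃
  (inj₂ (inj₂ refl)) (inj₁ refl)        → R-sym r₁₃
  (inj₂ (inj₂ refl)) (inj₂ (inj₁ refl)) → R-sym r₂₃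
  (inj₂ (inj₂ refl)) (inj₂ (inj₂ refl)) → ⊥-elim (p≢q refl)

mapBlock : ∀ {m n} → (Fin m → Fin n) → Block m → Block n
mapBlock f ⟨ p , q , r ⟩ = ⟨ f p , f q , f r ⟩

∈B-map⁺ : ∀ {m n} (f : Fin m → Fin n) {p bl} → p ∈B bl → f p ∈B mapBlock f bl
∈B-map⁺ f (inj₁ refl)        = inj₁ refl
∈B-map⁺ f (inj₂ (inj₁ refl)) = inj₂ (inj₁ refl)
∈B-map⁺ f (inj₂ (inj₂ refl)) = inj₂ (inj₂ refl)

∈B-map⁻ : ∀ {m n} {f : Fin m → Fin n} → Injective _≡_ _≡_ f → ∀ {p bl} → f p ∈B mapBlock f bl → p ∈B bl
∈B-map⁻ f-inj (inj₁ e)        = inj₁ (f-inj e)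
∈B-map⁻ f-inj (inj₂ (inj₁ e)) = inj₂ (inj₁ (f-inj e))
∈B-map⁻ f-inj (inj₂ (inj₂ e)) = inj₂ (inj₂ (f-inj e))

∉B-map : ∀ {m n} {f : Fin m → Fin n} {q} → (∀ p → f p ≢ q) → ∀ {bl} → ¬ q ∈B mapBlock f bl
∉B-map f≢q (inj₁ e)        = f≢q _ (sym e)
∉B-map f≢q (inj₂ (inj₁ e)) = f≢q _ (sym e)
∉B-map f≢q (inj₂ (inj₂ e)) = f≢q _ (sym e)

-- Counting incident blocks

incidentBlocks : ∀ {v} → Blocks v → Fin v → List (Fin v)
incidentBlocks {v} B p = filter (λ j → p ∈B? B j) (allFin v)

Enumerates : ∀ {v} → Blocks v → Fin v → List (Fin v) → Set
Enumerates B p js = Unique js × (∀ {j} → j ∈ js ⇔ p ∈B B j)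

incidentBlocks-enumerates : ∀ {v} (B : Blocks v) p → Enumerates B p (incidentBlocks B p)
incidentBlocks-enumerates {v} B p =
  filter⁺ incident? (allFin⁺ v) , mk⇔ (proj₂ ∘ ∈-filter⁻ incident? {xs = allFin v}) (∈-filter⁺ incident? (∈-allFin _))
  where
  incident? = λ j → p ∈B? B j

degree≡length : ∀ {v} {B : Blocks v} {p js} → Enumerates B p js → degree B p ≡ length js
degree≡length {B = B} {p} (js-unique , js-enum) with incidentBlocks-enumerates B p
... | incident-unique , incident-enum =
  ↭-length (∼bag⇒↭ (unique∧set⇒bag incident-unique js-unique (⇔-sym js-enum ⇔-∘ incident-enum)))

degree-transfer : ∀ {v w} {B : Blocks v} {B′ : Blocks w} {p p′} {g : Fin v → Fin w} → Injective _≡_ _≡_ g →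
  (∀ {j} → p ∈B B j → p′ ∈B B′ (g j)) → (∀ {j′} → p′ ∈B B′ j′ → ∃ λ j → p ∈B B j × j′ ≡ g j) →
  degree B′ p′ ≡ degree B p
degree-transfer {B = B} {B′} {p} {p′} {g} g-inj g-incident g-onto = begin
  degree B′ p′                        ≡⟨ degree≡length (map⁺ g-inj incident-unique , mk⇔ image⇒incident incident⇒image) ⟩
  length (map g (incidentBlocks B p)) ≡⟨ length-map g (incidentBlocks B p) ⟩
  degree B p                          ∎
  where
  open ≡-Reasoning
  incident-unique = proj₁ (incidentBlocks-enumerates B p)
  incident-enum = proj₂ (incidentBlocks-enumerates B p)
  image⇒incident : ∀ {j′} → j′ ∈ map g (incidentBlocks B p) → p′ ∈B B′ j′
  image⇒incident j′∈ with ∈-map⁻ g j′∈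
  ... | j , j∈ , refl = g-incident (Equivalence.to incident-enum j∈)
  incident⇒image : ∀ {j′} → p′ ∈B B′ j′ → j′ ∈ map g (incidentBlocks B p)
  incident⇒image p′∈ with g-onto p′∈
  ... | j , p∈ , refl = ∈-map⁺ g (Equivalence.from incident-enum p∈)

Linear : ∀ {v} → Blocks v → Set
Linear {v} B = ∀ (p q : Fin v) i j → p ≢ q → p ∈B B i → q ∈B B i → p ∈B B j → q ∈B B j → i ≡ j

SharesTwoPoints : ∀ {v} → Block v → Block v → Set
SharesTwoPoints bl bl′ = (b₁ bl ∈B bl′ × b₂ bl ∈B bl′) ⊎ (b₁ bl ∈B bl′ × b₃ bl ∈B bl′) ⊎ (b₂ bl ∈B bl′ × b₃ bl ∈B bl′)

sharesTwoPoints? : ∀ {v} (bl bl′ : Block v) → Dec (SharesTwoPoints bl bl′)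
sharesTwoPoints? bl bl′ =
  (b₁ bl ∈B? bl′ ×-dec b₂ bl ∈B? bl′) ⊎-dec (b₁ bl ∈B? bl′ ×-dec b₃ bl ∈B? bl′) ⊎-dec (b₂ bl ∈B? bl′ ×-dec b₃ bl ∈B? bl′)

linear-if-¬sharesTwoPoints : ∀ {v} {B : Blocks v} → (∀ i j → i ≢ j → ¬ SharesTwoPoints (B i) (B j)) → Linear B
linear-if-¬sharesTwoPoints {B = B} ¬share p q i j p≢q p∈i q∈i p∈j q∈j with i ≟ j
... | yes i≡j = i≡j
... | no i≢j  = ⊥-elim (¬share i j i≢j (pairwise-on-block R R-sym
        (λ x y → inj₁ (x , y)) (λ x y → inj₂ (inj₁ (x , y))) (λ x y → inj₂ (inj₂ (x , y)))
        p≢q p∈i q∈i p∈j q∈j))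
  where
  R = λ x y → x ∈B B j → y ∈B B j → SharesTwoPoints (B i) (B j)
  R-sym : Symmetric R
  R-sym r x∈ y∈ = r y∈ x∈

strong-separates : ∀ {v k} {B : Blocks v} {c : Fin v → Fin k} → StrongColouring B k c →
  ∀ {j p q} → p ≢ q → p ∈B B j → q ∈B B j → c p ≢ c q
strong-separates {c = c} strong {j} with strong j
... | c₁≢c₂ , c₁≢c₃ , c₂≢c₃ = pairwise-on-block (λ x y → c x ≢ c y) (λ r → r ∘ sym) c₁≢c₂ c₁≢c₃ c₂≢c₃

strong-∘ : ∀ {v k k′} {B : Blocks v} {c : Fin v → Fin k} {f : Fin k → Fin k′} → Injective _≡_ _≡_ f →
  StrongColouring B k c → StrongColouring B k′ (f ∘ c)
strong-∘ f-inj strong j = map-allDistinct f-inj (strong j)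

transpose-injective : ∀ {n} (i j : Fin n) → Injective _≡_ _≡_ (transpose i j)
transpose-injective i j {x} {y} e = begin
  x                               ≡⟨ transpose-inverse j i ⟨
  transpose j i (transpose i j x) ≡⟨ cong (transpose j i) e ⟩
  transpose j i (transpose i j y) ≡⟨ transpose-inverse j i ⟩
  y                               ∎
  where open ≡-Reasoning

transpose-source : ∀ {n} (i j : Fin n) → transpose i j i ≡ j
transpose-source i j rewrite dec-true (i ≟ i) refl = refl

-- Connectivity and cliques

Collinear : ∀ {v} → Blocks v → (Fin v → Set) → Fin v → Fin v → Set
Collinear B P p q = ∃ λ i → P i × p ∈B B i × q ∈B B i

ConnectedVia : ∀ {v} → Blocks v → (Fin v → Set) → Set
ConnectedVia {v} B P = (S : Fin v → Bool) → (∀ {p q} → Collinear B P p q → S p ≡ S q) → ∀ p q → S p ≡ S q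

connectedVia⇒connected : ∀ {v} {B : Blocks v} {P} → ConnectedVia B P → Connected B
connectedVia⇒connected {zero}  _         _ _      = inj₁ λ ()
connectedVia⇒connected {suc v} connected S closed = emptyOrFull (lookup S zero) refl
  where
  constant : ∀ p → lookup S p ≡ lookup S zero
  constant p = connected (lookup S) (λ (i , _ , p∈ , q∈) →
    ⇔→≡ (mk⇔ (λ p∈S → []=⇒lookup (closed i _ _ p∈ q∈ (lookup⇒[]= _ S p∈S)))
             (λ q∈S → []=⇒lookup (closed i _ _ q∈ p∈ (lookup⇒[]= _ S q∈S))))) p zero
  emptyOrFull : ∀ b → lookup S zero ≡ b → (∀ p → p ∉ₛ S) ⊎ (∀ p → p ∈ₛ S)
  emptyOrFull true  S₀ = inj₂ λ p → lookup⇒[]= p S (trans (constant p) S₀)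
  emptyOrFull false S₀ = inj₁ λ p p∈S → true≢false (trans (sym ([]=⇒lookup p∈S)) (trans (constant p) S₀))
    where
    true≢false : true ≢ false
    true≢false ()

constant-by-steps : ∀ {n} {A : Set} (f : Fin (suc n) → A) → (∀ k → f (inject₁ k) ≡ f (suc k)) → ∀ p → f zero ≡ f p
constant-by-steps         f step zero    = refl
constant-by-steps {suc n} f step (suc k) = trans (constant-by-steps (f ∘ inject₁) (step ∘ inject₁) k) (step k)

consecutive⇒connectedVia : ∀ {n} {B : Blocks (suc n)} {P} →
  (∀ k → Collinear B P (inject₁ k) (suc k)) → ConnectedVia B P
consecutive⇒connectedVia consecutive S closed p q =
  trans (sym (constant-by-steps S (closed ∘ consecutive) p)) (constant-by-steps S (closed ∘ consecutive) q)

Clique : ∀ {v r} → Blocks v → (Fin v → Set) → (Fin r → Fin v) → Set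
Clique B P κ = ∀ s t → s ≢ t → κ s ≢ κ t × Collinear B P (κ s) (κ t)

clique⇒¬colourable : ∀ {v r m} {B : Blocks v} {P} {κ : Fin r → Fin v} →
  Clique B P κ → m < r → ¬ StronglyColourable B m
clique⇒¬colourable {B = B} {κ = κ} clique m<r (c , strong) with pigeonhole m<r (c ∘ κ)
... | s , t , s<t , same-colour with clique s t (<⇒≢ s<t)
... | κs≢κt , _ , _ , s∈ , t∈ = strong-separates {B = B} {c} strong κs≢κt s∈ t∈ same-colour

-- Gluing two configurations

module Glue {m n : ℕ} (B₁ : Blocks m) (B₂ : Blocks n) (s₁ : Fin m) (s₂ : Fin n) where

  inl : Fin m → Fin (m + n)
  inl p = p ↑ˡ n

  inr : Fin n → Fin (m + n)
  inr q = m ↑ʳ q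

  inl-injective : Injective _≡_ _≡_ inl
  inl-injective = ↑ˡ-injective n _ _

  inr-injective : Injective _≡_ _≡_ inr
  inr-injective = ↑ʳ-injective m _ _

  inl≢inr : ∀ {p q} → inl p ≢ inr q
  inl≢inr {p} {q} e with trans (sym (splitAt-↑ˡ m p n)) (trans (cong (splitAt m) e) (splitAt-↑ʳ m n q))
  ... | ()

  data Side : Fin (m + n) → Set where
    left  : ∀ p → Side (inl p)
    right : ∀ q → Side (inr q)

  side : ∀ k → Side k
  side k = subst Side (join-splitAt m n k) (side-join (splitAt m k))
    where
    side-join : ∀ s → Side (join m n s)
    side-join (inj₁ p) = left p
    side-join (inj₂ q) = right q

  c : Fin m
  c = b₃ (B₁ s₁)

  z : Fin n
  z = b₃ (B₂ s₂)

  a : Fin m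
  a = b₁ (B₁ s₁)

  leftBlock : Fin m → Block (m + n)
  leftBlock i with i ≟ s₁
  ... | yes _ = ⟨ inl a , inl (b₂ (B₁ s₁)) , inr z ⟩
  ... | no  _ = mapBlock inl (B₁ i)

  rightBlock : Fin n → Block (m + n)
  rightBlock j with j ≟ s₂
  ... | yes _ = ⟨ inr (b₁ (B₂ s₂)) , inr (b₂ (B₂ s₂)) , inl c ⟩
  ... | no  _ = mapBlock inr (B₂ j)

  glue : Blocks (m + n)
  glue k = [ leftBlock , rightBlock ]′ (splitAt m k)

  glue-inl : ∀ i → glue (inl i) ≡ leftBlock i
  glue-inl i = cong [ leftBlock , rightBlock ]′ (splitAt-↑ˡ m i n)

  glue-inr : ∀ j → glue (inr j) ≡ rightBlock j
  glue-inr j = cong [ leftBlock , rightBlock ]′ (splitAt-↑ʳ m n j)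

  inl∈glue-inl⁺ : ∀ {p i} → p ∈B B₁ i → (i ≡ s₁ → p ≢ c) → inl p ∈B glue (inl i)
  inl∈glue-inl⁺ {p} {i} p∈ kept rewrite glue-inl i with i ≟ s₁
  ... | no _ = ∈B-map⁺ inl p∈
  ... | yes refl with p∈
  ...   | inj₁ refl        = inj₁ refl
  ...   | inj₂ (inj₁ refl) = inj₂ (inj₁ refl)
  ...   | inj₂ (inj₂ p≡c)  = ⊥-elim (kept refl p≡c)

  inr∈glue-inr⁺ : ∀ {q j} → q ∈B B₂ j → (j ≡ s₂ → q ≢ z) → inr q ∈B glue (inr j)
  inr∈glue-inr⁺ {q} {j} q∈ kept rewrite glue-inr j with j ≟ s₂
  ... | no _ = ∈B-map⁺ inr q∈
  ... | yes refl with q∈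
  ...   | inj₁ refl        = inj₁ refl
  ...   | inj₂ (inj₁ refl) = inj₂ (inj₁ refl)
  ...   | inj₂ (inj₂ q≡z)  = ⊥-elim (kept refl q≡z)

  z∈glue-s₁ : inr z ∈B glue (inl s₁)
  z∈glue-s₁ rewrite glue-inl s₁ with s₁ ≟ s₁
  ... | yes _   = inj₂ (inj₂ refl)
  ... | no s₁≢s₁ = ⊥-elim (s₁≢s₁ refl)

  a∈glue-s₁ : inl a ∈B glue (inl s₁)
  a∈glue-s₁ rewrite glue-inl s₁ with s₁ ≟ s₁
  ... | yes _   = inj₁ refl
  ... | no s₁≢s₁ = ⊥-elim (s₁≢s₁ refl)

  c∈glue-s₂ : inl c ∈B glue (inr s₂)
  c∈glue-s₂ rewrite glue-inr s₂ with s₂ ≟ s₂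
  ... | yes _   = inj₂ (inj₂ refl)
  ... | no s₂≢s₂ = ⊥-elim (s₂≢s₂ refl)

  inl∈glue-inr⁻ : ∀ {p j} → inl p ∈B glue (inr j) → j ≡ s₂ × p ≡ c
  inl∈glue-inr⁻ {p} {j} p∈ rewrite glue-inr j with j ≟ s₂
  ... | no _ = ⊥-elim (∉B-map {f = inr} (λ _ → inl≢inr ∘ sym) {B₂ j} p∈)
  ... | yes refl with p∈
  ...   | inj₁ e        = ⊥-elim (inl≢inr e)
  ...   | inj₂ (inj₁ e) = ⊥-elim (inl≢inr e)
  ...   | inj₂ (inj₂ e) = refl , inl-injective e

  inr∈glue-inl⁻ : ∀ {q i} → inr q ∈B glue (inl i) → i ≡ s₁ × q ≡ z
  inr∈glue-inl⁻ {q} {i} q∈ rewrite glue-inl i with i ≟ s₁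
  ... | no _ = ⊥-elim (∉B-map {f = inl} (λ _ → inl≢inr) {B₁ i} q∈)
  ... | yes refl with q∈
  ...   | inj₁ e        = ⊥-elim (inl≢inr (sym e))
  ...   | inj₂ (inj₁ e) = ⊥-elim (inl≢inr (sym e))
  ...   | inj₂ (inj₂ e) = refl , inr-injective e

  module _ (C₁ : IsConfig B₁) (C₂ : IsConfig B₂) where

    private
      distinct₁ = IsConfig.distinct C₁ s₁
      distinct₂ = IsConfig.distinct C₂ s₂

    inl∈glue-inl⁻ : ∀ {p i} → inl p ∈B glue (inl i) → p ∈B B₁ i × (i ≡ s₁ → p ≢ c)
    inl∈glue-inl⁻ {p} {i} p∈ rewrite glue-inl i with i ≟ s₁
    ... | no i≢s₁ = ∈B-map⁻ inl-injective p∈ , ⊥-elim ∘ i≢s₁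
    ... | yes refl with p∈
    ...   | inj₁ e        = inj₁ (inl-injective e) ,
                              λ _ p≡c → proj₁ (proj₂ distinct₁) (trans (sym (inl-injective e)) p≡c)
    ...   | inj₂ (inj₁ e) = inj₂ (inj₁ (inl-injective e)) ,
                              λ _ p≡c → proj₂ (proj₂ distinct₁) (trans (sym (inl-injective e)) p≡c)
    ...   | inj₂ (inj₂ e) = ⊥-elim (inl≢inr e)

    inr∈glue-inr⁻ : ∀ {q j} → inr q ∈B glue (inr j) → q ∈B B₂ j × (j ≡ s₂ → q ≢ z)
    inr∈glue-inr⁻ {q} {j} q∈ rewrite glue-inr j with j ≟ s₂
    ... | no j≢s₂ = ∈B-map⁻ inr-injective q∈ , ⊥-elim ∘ j≢s₂
    ... | yes refl with q∈
    ...   | inj₁ e        = inj₁ (inr-injective e) ,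
                              λ _ q≡z → proj₁ (proj₂ distinct₂) (trans (sym (inr-injective e)) q≡z)
    ...   | inj₂ (inj₁ e) = inj₂ (inj₁ (inr-injective e)) ,
                              λ _ q≡z → proj₂ (proj₂ distinct₂) (trans (sym (inr-injective e)) q≡z)
    ...   | inj₂ (inj₂ e) = ⊥-elim (inl≢inr (sym e))

    -- the block of the glue that takes over the role of block i of B₁ at the point p
    movedˡ : Fin m → Fin m → Fin (m + n)
    movedˡ p i with i ≟ s₁ | p ≟ c
    ... | yes _ | yes _ = inr s₂
    ... | _     | _     = inl i

    movedʳ : Fin n → Fin n → Fin (m + n)
    movedʳ q j with j ≟ s₂ | q ≟ z
    ... | yes _ | yes _ = inl s₁
    ... | _     | _     = inr j

    movedˡ-cases : ∀ p i → (i ≡ s₁ × p ≡ c × movedˡ p i ≡ inr s₂) ⊎ ((i ≡ s₁ → p ≢ c) × movedˡ p i ≡ inl i)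
    movedˡ-cases p i with i ≟ s₁ | p ≟ c
    ... | yes i≡s₁ | yes p≡c = inj₁ (i≡s₁ , p≡c , refl)
    ... | yes _    | no p≢c  = inj₂ ((λ _ → p≢c) , refl)
    ... | no i≢s₁  | _       = inj₂ (⊥-elim ∘ i≢s₁ , refl)

    movedʳ-cases : ∀ q j → (j ≡ s₂ × q ≡ z × movedʳ q j ≡ inl s₁) ⊎ ((j ≡ s₂ → q ≢ z) × movedʳ q j ≡ inr j)
    movedʳ-cases q j with j ≟ s₂ | q ≟ z
    ... | yes j≡s₂ | yes q≡z = inj₁ (j≡s₂ , q≡z , refl)
    ... | yes _    | no q≢z  = inj₂ ((λ _ → q≢z) , refl)
    ... | no j≢s₂  | _       = inj₂ (⊥-elim ∘ j≢s₂ , refl)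

    movedˡ-kept : ∀ {p i} → (i ≡ s₁ → p ≢ c) → movedˡ p i ≡ inl i
    movedˡ-kept {p} {i} kept with movedˡ-cases p i
    ... | inj₁ (i≡s₁ , p≡c , _) = ⊥-elim (kept i≡s₁ p≡c)
    ... | inj₂ (_ , e)          = e

    movedʳ-kept : ∀ {q j} → (j ≡ s₂ → q ≢ z) → movedʳ q j ≡ inr j
    movedʳ-kept {q} {j} kept with movedʳ-cases q j
    ... | inj₁ (j≡s₂ , q≡z , _) = ⊥-elim (kept j≡s₂ q≡z)
    ... | inj₂ (_ , e)          = e

    movedˡ-injective : ∀ p → Injective _≡_ _≡_ (movedˡ p)
    movedˡ-injective p {i} {i′} e with movedˡ-cases p i | movedˡ-cases p i′
    ... | inj₁ (i≡s₁ , _ , _) | inj₁ (i′≡s₁ , _ , _) = trans i≡s₁ (sym i′≡s₁)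
    ... | inj₁ (_ , _ , ei)   | inj₂ (_ , ei′)       = ⊥-elim (inl≢inr (trans (sym ei′) (trans (sym e) ei)))
    ... | inj₂ (_ , ei)       | inj₁ (_ , _ , ei′)   = ⊥-elim (inl≢inr (trans (sym ei) (trans e ei′)))
    ... | inj₂ (_ , ei)       | inj₂ (_ , ei′)       = inl-injective (trans (sym ei) (trans e ei′))

    movedʳ-injective : ∀ q → Injective _≡_ _≡_ (movedʳ q)
    movedʳ-injective q {j} {j′} e with movedʳ-cases q j | movedʳ-cases q j′
    ... | inj₁ (j≡s₂ , _ , _) | inj₁ (j′≡s₂ , _ , _) = trans j≡s₂ (sym j′≡s₂)
    ... | inj₁ (_ , _ , ej)   | inj₂ (_ , ej′)       = ⊥-elim (inl≢inr (trans (sym ej) (trans e ej′)))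
    ... | inj₂ (_ , ej)       | inj₁ (_ , _ , ej′)   = ⊥-elim (inl≢inr (trans (sym ej′) (trans (sym e) ej)))
    ... | inj₂ (_ , ej)       | inj₂ (_ , ej′)       = inr-injective (trans (sym ej) (trans e ej′))

    movedˡ-c : movedˡ c s₁ ≡ inr s₂
    movedˡ-c with s₁ ≟ s₁ | c ≟ c
    ... | yes _ | yes _ = refl
    ... | no ¬e | _     = ⊥-elim (¬e refl)
    ... | yes _ | no ¬e = ⊥-elim (¬e refl)

    movedʳ-z : movedʳ z s₂ ≡ inl s₁
    movedʳ-z with s₂ ≟ s₂ | z ≟ z
    ... | yes _ | yes _ = refl
    ... | no ¬e | _     = ⊥-elim (¬e refl)
    ... | yes _ | no ¬e = ⊥-elim (¬e refl)

    moved-inl∈glue : ∀ {p i} → p ∈B B₁ i → inl p ∈B glue (movedˡ p i)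
    moved-inl∈glue {p} {i} p∈ with movedˡ-cases p i
    ... | inj₁ (refl , refl , e) rewrite e = c∈glue-s₂
    ... | inj₂ (kept , e)        rewrite e = inl∈glue-inl⁺ p∈ kept

    moved-inr∈glue : ∀ {q j} → q ∈B B₂ j → inr q ∈B glue (movedʳ q j)
    moved-inr∈glue {q} {j} q∈ with movedʳ-cases q j
    ... | inj₁ (refl , refl , e) rewrite e = z∈glue-s₁
    ... | inj₂ (kept , e)        rewrite e = inr∈glue-inr⁺ q∈ kept

    inl∈glue-moved : ∀ {p k} → inl p ∈B glue k → ∃ λ i → p ∈B B₁ i × k ≡ movedˡ p i
    inl∈glue-moved {k = k} p∈ with side k
    ... | left i with inl∈glue-inl⁻ p∈
    ...   | p∈i , kept = i , p∈i , sym (movedˡ-kept kept)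
    inl∈glue-moved p∈ | right j with inl∈glue-inr⁻ p∈
    ...   | refl , refl = s₁ , inj₂ (inj₂ refl) , sym movedˡ-c

    inr∈glue-moved : ∀ {q k} → inr q ∈B glue k → ∃ λ j → q ∈B B₂ j × k ≡ movedʳ q j
    inr∈glue-moved {k = k} q∈ with side k
    ... | right j with inr∈glue-inr⁻ q∈
    ...   | q∈j , kept = j , q∈j , sym (movedʳ-kept kept)
    inr∈glue-moved q∈ | left i with inr∈glue-inl⁻ q∈
    ...   | refl , refl = s₂ , inj₂ (inj₂ refl) , sym movedʳ-z

    glue-regular : ∀ p → degree glue p ≡ 3
    glue-regular p with side p
    ... | left p₁  = trans (degree-transfer (movedˡ-injective p₁) moved-inl∈glue inl∈glue-moved) (IsConfig.regular C₁ p₁)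
    ... | right p₂ = trans (degree-transfer (movedʳ-injective p₂) moved-inr∈glue inr∈glue-moved) (IsConfig.regular C₂ p₂)

    common-block-inl : ∀ {p q k} → p ≢ q → inl p ∈B glue k → inl q ∈B glue k →
      ∃ λ i → k ≡ inl i × p ∈B B₁ i × q ∈B B₁ i
    common-block-inl {k = k} p≢q p∈ q∈ with side k
    ... | left i  = i , refl , proj₁ (inl∈glue-inl⁻ p∈) , proj₁ (inl∈glue-inl⁻ q∈)
    ... | right j = ⊥-elim (p≢q (trans (proj₂ (inl∈glue-inr⁻ p∈)) (sym (proj₂ (inl∈glue-inr⁻ q∈)))))

    common-block-inr : ∀ {p q k} → p ≢ q → inr p ∈B glue k → inr q ∈B glue k →
      ∃ λ j → k ≡ inr j × p ∈B B₂ j × q ∈B B₂ j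
    common-block-inr {k = k} p≢q p∈ q∈ with side k
    ... | right j = j , refl , proj₁ (inr∈glue-inr⁻ p∈) , proj₁ (inr∈glue-inr⁻ q∈)
    ... | left i  = ⊥-elim (p≢q (trans (proj₂ (inr∈glue-inl⁻ p∈)) (sym (proj₂ (inr∈glue-inl⁻ q∈)))))

    -- only the two switched blocks meet both sides, and which of them contains inl p depends only on p
    crossing-block : ∀ {p q k} → inl p ∈B glue k → inr q ∈B glue k → k ≡ movedˡ p s₁
    crossing-block {k = k} p∈ q∈ with side k
    ... | left i with inr∈glue-inl⁻ q∈
    ...   | refl , _ = sym (movedˡ-kept (proj₂ (inl∈glue-inl⁻ p∈)))
    crossing-block p∈ q∈ | right j with inl∈glue-inr⁻ p∈
    ...   | refl , refl = sym movedˡ-c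

    glue-linear : Linear glue
    glue-linear p q k k′ p≢q p∈k q∈k p∈k′ q∈k′ with side p | side q
    ... | left p₁ | left q₁
      with common-block-inl (p≢q ∘ cong inl) p∈k q∈k | common-block-inl (p≢q ∘ cong inl) p∈k′ q∈k′
    ...   | i , refl , p∈i , q∈i | i′ , refl , p∈i′ , q∈i′ =
      cong inl (IsConfig.linear C₁ p₁ q₁ i i′ (p≢q ∘ cong inl) p∈i q∈i p∈i′ q∈i′)
    glue-linear p q k k′ p≢q p∈k q∈k p∈k′ q∈k′ | right p₂ | right q₂
      with common-block-inr (p≢q ∘ cong inr) p∈k q∈k | common-block-inr (p≢q ∘ cong inr) p∈k′ q∈k′
    ...   | j , refl , p∈j , q∈j | j′ , refl , p∈j′ , q∈j′ =
      cong inr (IsConfig.linear C₂ p₂ q₂ j j′ (p≢q ∘ cong inr) p∈j q∈j p∈j′ q∈j′)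
    glue-linear p q k k′ p≢q p∈k q∈k p∈k′ q∈k′ | left _ | right _ =
      trans (crossing-block p∈k q∈k) (sym (crossing-block p∈k′ q∈k′))
    glue-linear p q k k′ p≢q p∈k q∈k p∈k′ q∈k′ | right _ | left _ =
      trans (crossing-block q∈k p∈k) (sym (crossing-block q∈k′ p∈k′))

    glue-nonDegenerate : ∀ k → AllDistinct (b₁ (glue k)) (b₂ (glue k)) (b₃ (glue k))
    glue-nonDegenerate k with side k
    ... | left i rewrite glue-inl i with i ≟ s₁
    ...   | yes refl = proj₁ distinct₁ ∘ inl-injective , inl≢inr , inl≢inr
    ...   | no _     = map-allDistinct inl-injective (IsConfig.distinct C₁ i)
    glue-nonDegenerate k | right j rewrite glue-inr j with j ≟ s₂
    ...   | yes refl = proj₁ distinct₂ ∘ inr-injective , inl≢inr ∘ sym , inl≢inr ∘ sym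
    ...   | no _     = map-allDistinct inr-injective (IsConfig.distinct C₂ j)

    glue-isConfig : IsConfig glue
    glue-isConfig = record { distinct = glue-nonDegenerate ; regular = glue-regular ; linear = glue-linear }

  module _ (k : Fin n) where

    collinear-inl : ∀ {p q} → Collinear B₁ (_≢ s₁) p q → Collinear glue (_≢ inr k) (inl p) (inl q)
    collinear-inl (i , i≢s₁ , p∈ , q∈) =
      inl i , inl≢inr , inl∈glue-inl⁺ p∈ (⊥-elim ∘ i≢s₁) , inl∈glue-inl⁺ q∈ (⊥-elim ∘ i≢s₁)

    collinear-inr : ∀ {p q} → Collinear B₂ (λ j → j ≢ s₂ × j ≢ k) p q → Collinear glue (_≢ inr k) (inr p) (inr q)
    collinear-inr (j , (j≢s₂ , j≢k) , p∈ , q∈) =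
      inr j , j≢k ∘ inr-injective , inr∈glue-inr⁺ p∈ (⊥-elim ∘ j≢s₂) , inr∈glue-inr⁺ q∈ (⊥-elim ∘ j≢s₂)

    glue-connected : ConnectedVia B₁ (_≢ s₁) → ConnectedVia B₂ (λ j → j ≢ s₂ × j ≢ k) → ConnectedVia glue (_≢ inr k)
    glue-connected connected₁ connected₂ S closed p q = trans (toBase p) (sym (toBase q))
      where
      across : S (inl a) ≡ S (inr z)
      across = closed (inl s₁ , inl≢inr , a∈glue-s₁ , z∈glue-s₁)
      toBase : ∀ p → S p ≡ S (inl a)
      toBase p with side p
      ... | left p₁  = connected₁ (S ∘ inl) (closed ∘ collinear-inl) p₁ a
      ... | right p₂ = trans (connected₂ (S ∘ inr) (closed ∘ collinear-inr) p₂ z) (sym across)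

    glue-clique : ∀ {r} {κ : Fin r → Fin m} → Clique B₁ (_≢ s₁) κ → Clique glue (_≢ inr k) (inl ∘ κ)
    glue-clique clique s t s≢t = proj₁ (clique s t s≢t) ∘ inl-injective , collinear-inl (proj₂ (clique s t s≢t))

  module _ {r} (c₁ : Fin m → Fin r) (c₂ : Fin n → Fin r) where

    joinColours : Fin (m + n) → Fin r
    joinColours = [ c₁ , c₂ ]′ ∘ splitAt m

    joinColours-inl : ∀ p → joinColours (inl p) ≡ c₁ p
    joinColours-inl p = cong [ c₁ , c₂ ]′ (splitAt-↑ˡ m p n)

    joinColours-inr : ∀ q → joinColours (inr q) ≡ c₂ q
    joinColours-inr q = cong [ c₁ , c₂ ]′ (splitAt-↑ʳ m n q)

    -- c and z exchange blocks, so they must receive the same colour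
    glue-strong : c₁ c ≡ c₂ z → StrongColouring B₁ r c₁ → StrongColouring B₂ r c₂ → StrongColouring glue r joinColours
    glue-strong same strong₁ strong₂ k with side k
    ... | left i rewrite glue-inl i with i ≟ s₁
    ...   | yes refl = allDistinct-cong (sym (joinColours-inl _)) (sym (joinColours-inl _))
                         (trans same (sym (joinColours-inr z))) (strong₁ s₁)
    ...   | no _     = allDistinct-cong (sym (joinColours-inl _)) (sym (joinColours-inl _))
                         (sym (joinColours-inl _)) (strong₁ i)
    glue-strong same strong₁ strong₂ k | right j rewrite glue-inr j with j ≟ s₂
    ...   | yes refl = allDistinct-cong (sym (joinColours-inr _)) (sym (joinColours-inr _))
                         (trans (sym same) (sym (joinColours-inl c))) (strong₂ s₂)
    ...   | no _     = allDistinct-cong (sym (joinColours-inr _)) (sym (joinColours-inr _))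
                         (sym (joinColours-inr _)) (strong₂ j)

-- Small configurations and the induction

-- The switch is the block that the next gluing destroys, so connectivity and the clique must avoid it.
record Extendable (v : ℕ) : Set where
  field
    blocks    : Blocks v
    isConfig  : IsConfig blocks
    colouring : Fin v → Fin 4
    strong    : StrongColouring blocks 4 colouring
    switch    : Fin v
    connected : ConnectedVia blocks (_≢ switch)
    clique    : Fin 4 → Fin v
    isClique  : Clique blocks (_≢ switch) clique

extendable⇒theorem : ∀ {v} → Extendable v → Σ (Blocks v) (λ B → IsConfig B × Connected B × StrongChromaticNumber B 4)
extendable⇒theorem E =
  blocks , isConfig , connectedVia⇒connected connected , (colouring , strong) , λ _ → clique⇒¬colourable isClique
  where open Extendable E

module _ {v : ℕ} (B : Blocks v) where

  nonDegenerate? : Dec (∀ j → AllDistinct (b₁ (B j)) (b₂ (B j)) (b₃ (B j)))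
  nonDegenerate? = all? λ j → allDistinct? _≟_ (b₁ (B j)) (b₂ (B j)) (b₃ (B j))

  regular? : Dec (∀ p → degree B p ≡ 3)
  regular? = all? λ p → degree B p ≟ℕ 3

  noSharesTwoPoints? : Dec (∀ i j → i ≢ j → ¬ SharesTwoPoints (B i) (B j))
  noSharesTwoPoints? = all? λ i → all? λ j → ¬? (i ≟ j) →-dec ¬? (sharesTwoPoints? (B i) (B j))

  strong? : (c : Fin v → Fin 4) → Dec (StrongColouring B 4 c)
  strong? c = all? λ j → allDistinct? _≟_ (c (b₁ (B j))) (c (b₂ (B j))) (c (b₃ (B j)))

  collinear? : ∀ {P} → Decidable P → ∀ p q → Dec (Collinear B P p q)
  collinear? P? p q = any? λ i → P? i ×-dec p ∈B? B i ×-dec q ∈B? B i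

  clique? : ∀ {r P} → Decidable P → (κ : Fin r → Fin v) → Dec (Clique B P κ)
  clique? P? κ = all? λ s → all? λ t → ¬? (s ≟ t) →-dec (¬? (κ s ≟ κ t) ×-dec collinear? P? (κ s) (κ t))

consecutive? : ∀ {n} (B : Blocks (suc n)) {P} → Decidable P → Dec (∀ k → Collinear B P (inject₁ k) (suc k))
consecutive? B P? = all? λ k → collinear? B P? (inject₁ k) (suc k)

certified : ∀ {n} (B : Blocks (suc n)) (c : Fin (suc n) → Fin 4) (s : Fin (suc n)) (κ : Fin 4 → Fin (suc n)) →
  {_ : True (nonDegenerate? B)} {_ : True (regular? B)} {_ : True (noSharesTwoPoints? B)} {_ : True (strong? B c)}
  {_ : True (consecutive? B (λ j → ¬? (j ≟ s)))} {_ : True (clique? B (λ j → ¬? (j ≟ s)) κ)} → Extendable (suc n)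
certified B c s κ {nonDegenerate} {regular} {noSharesTwoPoints} {strong} {consecutive} {clique} = record
  { blocks    = B
  ; isConfig  = record
    { distinct = toWitness nonDegenerate
    ; regular  = toWitness regular
    ; linear   = linear-if-¬sharesTwoPoints (toWitness noSharesTwoPoints)
    }
  ; colouring = c
  ; strong    = toWitness strong
  ; switch    = s
  ; connected = consecutive⇒connectedVia (toWitness consecutive)
  ; clique    = κ
  ; isClique  = toWitness clique
  }

B₈ : Blocks 8
B₈ = lookup
  ( ⟨ # 6 , # 1 , # 7 ⟩ ∷ ⟨ # 1 , # 2 , # 0 ⟩ ∷ ⟨ # 1 , # 5 , # 3 ⟩ ∷ ⟨ # 6 , # 5 , # 4 ⟩ ∷ ⟨ # 7 , # 5 , # 2 ⟩
  ∷ ⟨ # 6 , # 3 , # 0 ⟩ ∷ ⟨ # 2 , # 4 , # 3 ⟩ ∷ ⟨ # 0 , # 4 , # 7 ⟩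
  ∷ [])

extendable₈ : Extendable 8
extendable₈ = certified B₈
  (lookup (# 2 ∷ # 3 ∷ # 0 ∷ # 1 ∷ # 3 ∷ # 2 ∷ # 0 ∷ # 1 ∷ []))
  (# 4)
  (lookup (# 0 ∷ # 1 ∷ # 2 ∷ # 3 ∷ []))

B₉ : Blocks 9
B₉ = lookup
  ( ⟨ # 7 , # 5 , # 8 ⟩ ∷ ⟨ # 7 , # 3 , # 4 ⟩ ∷ ⟨ # 7 , # 6 , # 2 ⟩ ∷ ⟨ # 4 , # 6 , # 5 ⟩ ∷ ⟨ # 8 , # 6 , # 0 ⟩
  ∷ ⟨ # 4 , # 0 , # 1 ⟩ ∷ ⟨ # 5 , # 2 , # 1 ⟩ ∷ ⟨ # 8 , # 3 , # 1 ⟩ ∷ ⟨ # 0 , # 3 , # 2 ⟩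
  ∷ [])

extendable₉ : Extendable 9
extendable₉ = certified B₉
  (lookup (# 0 ∷ # 1 ∷ # 2 ∷ # 3 ∷ # 2 ∷ # 0 ∷ # 3 ∷ # 1 ∷ # 2 ∷ []))
  (# 4)
  (lookup (# 0 ∷ # 1 ∷ # 2 ∷ # 3 ∷ []))

B₁₀ : Blocks 10
B₁₀ = lookup
  ( ⟨ # 5 , # 4 , # 2 ⟩ ∷ ⟨ # 5 , # 6 , # 8 ⟩ ∷ ⟨ # 9 , # 5 , # 1 ⟩ ∷ ⟨ # 4 , # 3 , # 8 ⟩ ∷ ⟨ # 4 , # 0 , # 7 ⟩
  ∷ ⟨ # 8 , # 9 , # 7 ⟩ ∷ ⟨ # 9 , # 0 , # 3 ⟩ ∷ ⟨ # 3 , # 2 , # 1 ⟩ ∷ ⟨ # 0 , # 6 , # 1 ⟩ ∷ ⟨ # 6 , # 7 , # 2 ⟩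
  ∷ [])

extendable₁₀ : Extendable 10
extendable₁₀ = certified B₁₀
  (lookup (# 0 ∷ # 1 ∷ # 0 ∷ # 2 ∷ # 1 ∷ # 2 ∷ # 3 ∷ # 2 ∷ # 0 ∷ # 3 ∷ []))
  (# 4)
  (lookup (# 0 ∷ # 1 ∷ # 3 ∷ # 9 ∷ []))

B₁₁ : Blocks 11
B₁₁ = lookup
  ( ⟨ # 0 , # 7 , # 5 ⟩ ∷ ⟨ # 7 , # 8 , # 9 ⟩ ∷ ⟨ # 7 , # 2 , # 6 ⟩ ∷ ⟨ # 5 , # 10 , # 9 ⟩ ∷ ⟨ # 9 , # 2 , # 3 ⟩
  ∷ ⟨ # 5 , # 6 , # 4 ⟩ ∷ ⟨ # 6 , # 3 , # 8 ⟩ ∷ ⟨ # 8 , # 0 , # 1 ⟩ ∷ ⟨ # 10 , # 0 , # 4 ⟩ ∷ ⟨ # 10 , # 1 , # 2 ⟩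
  ∷ ⟨ # 4 , # 1 , # 3 ⟩
  ∷ [])

extendable₁₁ : Extendable 11
extendable₁₁ = certified B₁₁
  (lookup (# 0 ∷ # 1 ∷ # 2 ∷ # 3 ∷ # 2 ∷ # 1 ∷ # 0 ∷ # 3 ∷ # 2 ∷ # 0 ∷ # 3 ∷ []))
  (# 0)
  (lookup (# 0 ∷ # 1 ∷ # 4 ∷ # 10 ∷ []))

B₁₂ : Blocks 12
B₁₂ = lookup
  ( ⟨ # 11 , # 10 , # 6 ⟩ ∷ ⟨ # 11 , # 7 , # 1 ⟩ ∷ ⟨ # 11 , # 4 , # 5 ⟩ ∷ ⟨ # 1 , # 2 , # 5 ⟩ ∷ ⟨ # 1 , # 10 , # 0 ⟩
  ∷ ⟨ # 5 , # 6 , # 3 ⟩ ∷ ⟨ # 6 , # 7 , # 8 ⟩ ∷ ⟨ # 10 , # 9 , # 7 ⟩ ∷ ⟨ # 9 , # 3 , # 0 ⟩ ∷ ⟨ # 3 , # 2 , # 4 ⟩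
  ∷ ⟨ # 9 , # 2 , # 8 ⟩ ∷ ⟨ # 0 , # 4 , # 8 ⟩
  ∷ [])

extendable₁₂ : Extendable 12
extendable₁₂ = certified B₁₂
  (lookup (# 0 ∷ # 1 ∷ # 0 ∷ # 2 ∷ # 1 ∷ # 3 ∷ # 1 ∷ # 0 ∷ # 2 ∷ # 1 ∷ # 3 ∷ # 2 ∷ []))
  (# 1)
  (lookup (# 2 ∷ # 3 ∷ # 4 ∷ # 5 ∷ []))

B₁₃ : Blocks 13
B₁₃ = lookup
  ( ⟨ # 5 , # 6 , # 7 ⟩ ∷ ⟨ # 7 , # 8 , # 12 ⟩ ∷ ⟨ # 7 , # 1 , # 3 ⟩ ∷ ⟨ # 5 , # 11 , # 4 ⟩ ∷ ⟨ # 12 , # 5 , # 9 ⟩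
  ∷ ⟨ # 12 , # 10 , # 11 ⟩ ∷ ⟨ # 11 , # 6 , # 8 ⟩ ∷ ⟨ # 6 , # 1 , # 2 ⟩ ∷ ⟨ # 8 , # 9 , # 0 ⟩ ∷ ⟨ # 1 , # 4 , # 0 ⟩
  ∷ ⟨ # 0 , # 10 , # 2 ⟩ ∷ ⟨ # 4 , # 2 , # 3 ⟩ ∷ ⟨ # 3 , # 10 , # 9 ⟩
  ∷ [])

extendable₁₃ : Extendable 13
extendable₁₃ = certified B₁₃
  (lookup (# 0 ∷ # 1 ∷ # 2 ∷ # 0 ∷ # 3 ∷ # 0 ∷ # 3 ∷ # 2 ∷ # 1 ∷ # 2 ∷ # 1 ∷ # 2 ∷ # 3 ∷ []))
  (# 4)
  (lookup (# 0 ∷ # 1 ∷ # 2 ∷ # 4 ∷ []))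

B₁₄ : Blocks 14
B₁₄ = lookup
  ( ⟨ # 7 , # 8 , # 13 ⟩ ∷ ⟨ # 8 , # 5 , # 4 ⟩ ∷ ⟨ # 8 , # 10 , # 9 ⟩ ∷ ⟨ # 7 , # 6 , # 5 ⟩ ∷ ⟨ # 5 , # 3 , # 9 ⟩
  ∷ ⟨ # 7 , # 11 , # 12 ⟩ ∷ ⟨ # 9 , # 0 , # 4 ⟩ ∷ ⟨ # 4 , # 3 , # 2 ⟩ ∷ ⟨ # 13 , # 3 , # 0 ⟩ ∷ ⟨ # 0 , # 11 , # 1 ⟩
  ∷ ⟨ # 13 , # 1 , # 12 ⟩ ∷ ⟨ # 11 , # 10 , # 6 ⟩ ∷ ⟨ # 1 , # 10 , # 2 ⟩ ∷ ⟨ # 2 , # 6 , # 12 ⟩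
  ∷ [])

extendable₁₄ : Extendable 14
extendable₁₄ = certified B₁₄
  (lookup (# 0 ∷ # 1 ∷ # 2 ∷ # 1 ∷ # 3 ∷ # 0 ∷ # 1 ∷ # 2 ∷ # 1 ∷ # 2 ∷ # 0 ∷ # 3 ∷ # 0 ∷ # 3 ∷ []))
  (# 8)
  (lookup (# 3 ∷ # 4 ∷ # 5 ∷ # 9 ∷ []))

B₁₅ : Blocks 15
B₁₅ = lookup
  ( ⟨ # 1 , # 11 , # 10 ⟩ ∷ ⟨ # 11 , # 13 , # 9 ⟩ ∷ ⟨ # 11 , # 0 , # 12 ⟩ ∷ ⟨ # 12 , # 9 , # 8 ⟩ ∷ ⟨ # 12 , # 13 , # 5 ⟩
  ∷ ⟨ # 9 , # 10 , # 2 ⟩ ∷ ⟨ # 10 , # 4 , # 5 ⟩ ∷ ⟨ # 5 , # 0 , # 6 ⟩ ∷ ⟨ # 13 , # 14 , # 1 ⟩ ∷ ⟨ # 1 , # 0 , # 2 ⟩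
  ∷ ⟨ # 2 , # 3 , # 7 ⟩ ∷ ⟨ # 14 , # 4 , # 7 ⟩ ∷ ⟨ # 14 , # 3 , # 6 ⟩ ∷ ⟨ # 4 , # 3 , # 8 ⟩ ∷ ⟨ # 7 , # 6 , # 8 ⟩
  ∷ [])

extendable₁₅ : Extendable 15
extendable₁₅ = certified B₁₅
  (lookup (# 0 ∷ # 1 ∷ # 2 ∷ # 0 ∷ # 1 ∷ # 2 ∷ # 1 ∷ # 3 ∷ # 2 ∷ # 0 ∷ # 3 ∷ # 2 ∷ # 1 ∷ # 3 ∷ # 2 ∷ []))
  (# 11)
  (lookup (# 3 ∷ # 6 ∷ # 7 ∷ # 8 ∷ []))

-- When B₈ is glued on the right, its block # 5 is exchanged and its block # 4 becomes the new switch.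
B₈-connected : ConnectedVia B₈ (λ j → j ≢ # 5 × j ≢ # 4)
B₈-connected = consecutive⇒connectedVia (toWitness {a? = consecutive? B₈ (λ j → ¬? (j ≟ # 5) ×-dec ¬? (j ≟ # 4))} _)

extend : ∀ {m} → Extendable m → Extendable (m + 8)
extend E = record
  { blocks    = glue
  ; isConfig  = glue-isConfig isConfig E₈.isConfig
  ; colouring = joinColours colouring recoloured₈
  ; strong    = glue-strong colouring recoloured₈ (sym (transpose-source (E₈.colouring z) (colouring c))) strong
                  (strong-∘ {B = B₈} {c = E₈.colouring} (transpose-injective (E₈.colouring z) (colouring c)) E₈.strong)
  ; switch    = inr (# 4)
  ; connected = glue-connected (# 4) connected B₈-connected
  ; clique    = inl ∘ clique
  ; isClique  = glue-clique (# 4) isClique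
  }
  where
  open Extendable E
  module E₈ = Extendable extendable₈
  open Glue blocks B₈ switch (# 5)
  recoloured₈ : Fin 8 → Fin 4
  recoloured₈ = transpose (E₈.colouring z) (colouring c) ∘ E₈.colouring

extendable : ∀ n → Extendable (8 + n)
extendable 0 = extendable₈
extendable 1 = extendable₉
extendable 2 = extendable₁₀
extendable 3 = extendable₁₁
extendable 4 = extendable₁₂
extendable 5 = extendable₁₃
extendable 6 = extendable₁₄
extendable 7 = extendable₁₅
extendable (suc (suc (suc (suc (suc (suc (suc (suc n)))))))) = subst Extendable (+-comm (8 + n) 8) (extend (extendable n))

theorem20 : (v : ℕ) → v ≥ 8 →
    Σ (Blocks v) (λ B → IsConfig B × Connected B × StrongChromaticNumber B 4)
theorem20 v v≥8 = subst (λ w → Σ (Blocks w) (λ B → IsConfig B × Connected B × StrongChromaticNumber B 4))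
  (m+[n∸m]≡n v≥8) (extendable⇒theorem (extendable (v ∸ 8)))
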